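{- Let $G=(V,E)$ be an equatorial graph with girth $g$ and equator $q$, let $k=\lceil g/2\rceil-1$, and let $C=u_0,\dots,u_{q-1}$ be an isometric cycle of length $q$ in $G$. For $i\in\{0,\dots,q-1\}$ set $L_i=\mathcal{D}_k(u_{i-k})\cap\mathcal{D}_k(u_{i+k})$ (indices mod $q$). Then the sets $L_0,\dots,L_{q-1}$ partition $V$, and $u_i\in L_i$ for every $i$.
   Context: For a vertex $u$, $\mathcal{D}_i(u)=\{v: d(u,v)\le i\}$. A cycle $C$ is isometric if $d_C(x,y)=d_G(x,y)$ for all $x,y\in V(C)$; the equator is the length of a longest isometric cycle. For $\delta\ge2$, $g\ge3$, $k=\lceil g/2\rceil-1$, the Moore bound is $M(\delta,g)=1+\sum_{i=0}^{k-1}\delta(\delta-1)^i$ for odd $g$ and $M(\delta,g)=2+\sum_{i=1}^{k}2(\delta-1)^i$ for even $g$. An equatorial graph is a finite graph with girth $g$, minimum degree $\delta$ and equator $q>6k+3$ whose order is exactly $\frac{q}{g}M(\delta,g)$. -}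

module Defs where

open import Data.Nat using (ℕ; zero; suc; _+_; _*_; _∸_; _≤_; _<_; _/_; ∣_-_∣; _⊓_)
open import Data.Nat.DivMod using (_mod_)
open import Data.Fin using (Fin; toℕ)
open import Data.Bool using (Bool; true; false; if_then_else_)
open import Data.List using (List; map; allFin)
open import Data.Nat.ListAction using (sum)
open import Data.Product using (Σ; ∃; ∃-syntax; _×_; _,_)
open import Relation.Nullary using (¬_)
open import Relation.Binary.PropositionalEquality using (_≡_)
open import Function.Definitions using (Injective)

record Graph (n : ℕ) : Set where
  field
    adj    : Fin n → Fin n → Bool
    sym    : ∀ u v → adj u v ≡ adj v u
    irrefl : ∀ u → adj u u ≡ false
open Graph public

module _ {n : ℕ} (G : Graph n) where

  data Walk : Fin n → Fin n → ℕ → Set where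
    nil  : ∀ {u} → Walk u u 0
    cons : ∀ {u v w ℓ} → adj G u v ≡ true → Walk v w ℓ → Walk u w (suc ℓ)

  Dist : Fin n → Fin n → ℕ → Set
  Dist u v m = Walk u v m × (∀ ℓ → ℓ < m → ¬ Walk u v ℓ)

  InBall : ℕ → Fin n → Fin n → Set
  InBall i u v = ∃[ ℓ ] (ℓ ≤ i × Walk u v ℓ)

  degree : Fin n → ℕ
  degree u = sum (map (λ v → if adj G u v then 1 else 0) (allFin n))

  MinDegree : ℕ → Set
  MinDegree δ = (∃[ v ] degree v ≡ δ) × (∀ v → δ ≤ degree v)

shift : {q : ℕ} → Fin q → ℕ → Fin q
shift {suc q'} i m = (toℕ i + m) mod (suc q')

-- i - m (mod q), using -m ≡ m (q - 1) (mod q)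
unshift : {q : ℕ} → Fin q → ℕ → Fin q
unshift {q} i m = shift i (m * (q ∸ 1))

cdist : (q : ℕ) → Fin q → Fin q → ℕ
cdist q i j = ∣ toℕ i - toℕ j ∣ ⊓ (q ∸ ∣ toℕ i - toℕ j ∣)

module _ {n : ℕ} (G : Graph n) where

  record Cycle (q : ℕ) : Set where
    field
      len≥3 : 3 ≤ q
      vert  : Fin q → Fin n
      inj   : Injective _≡_ _≡_ vert
      edges : ∀ i → adj G (vert i) (vert (shift i 1)) ≡ true
  open Cycle public

  IsIsometric : {q : ℕ} → Cycle q → Set
  IsIsometric {q} C = ∀ i j → Dist G (vert C i) (vert C j) (cdist q i j)

  HasGirth : ℕ → Set
  HasGirth g = Cycle g × (∀ {m} → Cycle m → g ≤ m)

  HasEquator : ℕ → Set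
  HasEquator q = (Σ (Cycle q) IsIsometric) × (∀ {m} (C : Cycle m) → IsIsometric C → m ≤ q)

kOf : ℕ → ℕ
kOf g = ((g + 1) / 2) ∸ 1

pow : ℕ → ℕ → ℕ
pow b zero = 1
pow b (suc e) = b * pow b e

sumTo : ℕ → (ℕ → ℕ) → ℕ
sumTo zero f = 0
sumTo (suc m) f = sumTo m f + f m

odd? : ℕ → Bool
odd? zero = false
odd? (suc zero) = true
odd? (suc (suc m)) = odd? m

Moore : ℕ → ℕ → ℕ
Moore δ g with odd? g
... | true  = 1 + sumTo (kOf g) (λ i → δ * pow (δ ∸ 1) i)
... | false = 2 + sumTo (kOf g) (λ i → 2 * pow (δ ∸ 1) (suc i))

-- Equatorial graph: girth g, min degree δ ≥ 2, equator q > 6k+3,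
-- and order n = (q/g) M(δ,g), stated as n * g = q * M(δ,g).
record Equatorial {n : ℕ} (G : Graph n) (g δ q : ℕ) : Set where
  field
    δ≥2    : 2 ≤ δ
    girth  : HasGirth G g
    mindeg : MinDegree G δ
    equat  : HasEquator G q
    big    : 6 * kOf g + 3 < q
    order  : n * g ≡ q * Moore δ g

InL : {n : ℕ} (G : Graph n) {q : ℕ} (C : Cycle G q) (k : ℕ) → Fin q → Fin n → Set
InL G C k i v = InBall G k (vert C (unshift i k)) v × InBall G k (vert C (shift i k)) v

{-# OPTIONS --safe #-}
-- Write g = 2k + 1 + e with e ∈ {0, 1}. Around every position p of C take the centre u_p (e = 0) or
-- the edge u_p u_{p+1} (e = 1); by the girth, the breadth-first layers around it grow by a factor
-- δ - 1, so the vertices within distance k of the centre number at least M(δ, g). Summing over the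
-- q positions gives at least q M(δ, g) = n g incidences. On the other hand C is isometric, so the
-- positions p with d(v, u_p) ≤ k are pairwise within cyclic distance 2k; since q > 6k + 3 they lie
-- on an arc of 2k + 1 consecutive positions, and v meets at most 2k + 1 + e = g of the centres'
-- balls. Hence every v meets exactly g of them, which forces the arc to be full:
-- d(v, u_p) ≤ k and d(v, u_{p+2k}) ≤ k, i.e. v ∈ L_{p+k}, and the arc determines p modulo q.
module Submission where

open import Data.Bool using (true; false; if_then_else_)
open import Data.Bool.Properties using () renaming (_≟_ to _≟ᵇ_)
open import Data.Empty using (⊥; ⊥-elim)
open import Data.Fin using (Fin; zero; suc; toℕ)
open import Data.Fin.Properties using (any?; toℕ-injective; toℕ<n; toℕ-fromℕ<) renaming (_≟_ to _≟ᶠ_; suc-injective to suc-injectiveᶠ; 0≢1+n to 0≢1+nᶠ)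
open import Data.List using (map; allFin; tabulate)
open import Data.List.Properties using (map-tabulate)
open import Data.Nat
open import Data.Nat.DivMod using (_mod_; _%_; m<n⇒m%n≡m; n%n≡0; m%n<n; [m+n]%n≡m%n; [m+kn]%n≡m%n; %-distribˡ-+; m%n%n≡m%n; m≡m%n+[m/n]*n; /-congˡ; +-distrib-/-∣ʳ; m<n⇒m/n≡0; m*n/n≡m)
open import Data.Nat.Divisibility using (divides-refl)
import Data.Nat.ListAction as List
open import Data.Nat.Properties
open import Algebra.Properties.CommutativeMonoid.Sum +-0-commutativeMonoid using (sum; sum-syntax; sum-cong-≗; ∑-comm; ∑-distrib-+)
open import Algebra.Properties.Semiring.Sum +-*-semiring using (*-distribˡ-sum; *-distribʳ-sum)
open import Data.Nat.Tactic.RingSolver using (solve-∀)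
open import Data.Product using (∃; ∃-syntax; _×_; _,_; proj₁; proj₂)
open import Data.Sum using (_⊎_; inj₁; inj₂)
open import Function using (_∘_)
open import Relation.Binary.Definitions using (tri<; tri≈; tri>)
open import Relation.Binary.PropositionalEquality
open import Relation.Nullary
open import Relation.Nullary.Decidable using (_×-dec_; _⊎-dec_; map′)
open import Relation.Unary using (Pred; Decidable)
open import Defs hiding (sym)

m∸n≡1+[m∸1+n] : ∀ {m s} → s < m → m ∸ s ≡ suc (m ∸ suc s)
m∸n≡1+[m∸1+n] {suc m} {zero}  _         = refl
m∸n≡1+[m∸1+n] {suc m} {suc s} (s≤s s<m) = m∸n≡1+[m∸1+n] s<m

χ : ∀ {p} {P : Set p} → Dec P → ℕ
χ (yes _) = 1
χ (no _)  = 0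

module _ {p} {P : Set p} where

  χ≤1 : (d : Dec P) → χ d ≤ 1
  χ≤1 (yes _) = ≤-refl
  χ≤1 (no _)  = z≤n

  χ-yes : (d : Dec P) → P → χ d ≡ 1
  χ-yes (yes _) _  = refl
  χ-yes (no ¬p) p  = ⊥-elim (¬p p)

  χ-no : (d : Dec P) → ¬ P → χ d ≡ 0
  χ-no (yes p) ¬p = ⊥-elim (¬p p)
  χ-no (no _)  _  = refl

  χ*-mono : (d : Dec P) {a b : ℕ} → (P → a ≤ b) → χ d * a ≤ χ d * b
  χ*-mono (yes p) a≤b = +-monoˡ-≤ 0 (a≤b p)
  χ*-mono (no _)  _   = z≤n

χ-mono : ∀ {p q} {P : Set p} {Q : Set q} → (P → Q) → (dp : Dec P) (dq : Dec Q) → χ dp ≤ χ dq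
χ-mono f (yes p) dq = ≤-reflexive (sym (χ-yes dq (f p)))
χ-mono f (no _)  dq = z≤n

χ-cong : ∀ {p q} {P : Set p} {Q : Set q} → (P → Q) → (Q → P) → (dp : Dec P) (dq : Dec Q) → χ dp ≡ χ dq
χ-cong f g dp dq = ≤-antisym (χ-mono f dp dq) (χ-mono g dq dp)

χ-× : ∀ {p q} {P : Set p} {Q : Set q} (dp : Dec P) (dq : Dec Q) → χ (dp ×-dec dq) ≡ χ dp * χ dq
χ-× (yes _) (yes _) = refl
χ-× (yes _) (no _)  = refl
χ-× (no _)  _       = refl

χ-if : ∀ b → (if b then 1 else 0) ≡ χ (b ≟ᵇ true)
χ-if true  = refl
χ-if false = refl

sum-mono-≤ : ∀ {n} {f g : Fin n → ℕ} → (∀ i → f i ≤ g i) → sum f ≤ sum g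
sum-mono-≤ {zero}  f≤g = z≤n
sum-mono-≤ {suc n} f≤g = +-mono-≤ (f≤g zero) (sum-mono-≤ (f≤g ∘ suc))

sum-const : ∀ n m → ∑[ i < n ] m ≡ n * m
sum-const zero    m = refl
sum-const (suc n) m = cong (m +_) (sum-const n m)

sum-tabulate : ∀ {n} (f : Fin n → ℕ) → List.sum (tabulate f) ≡ sum f
sum-tabulate {zero}  f = refl
sum-tabulate {suc n} f = cong (f zero +_) (sum-tabulate (f ∘ suc))

listSum-allFin : ∀ {n} (f : Fin n → ℕ) → List.sum (map f (allFin n)) ≡ sum f
listSum-allFin f = trans (cong List.sum (map-tabulate (λ i → i) f)) (sum-tabulate f)

n*m≤sum⇒m≤each : ∀ {n} m (f : Fin n → ℕ) → (∀ i → f i ≤ m) → n * m ≤ sum f → ∀ i → m ≤ f i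
n*m≤sum⇒m≤each {suc n} m f f≤m total zero =
  +-cancelʳ-≤ (n * m) m (f zero)
    (≤-trans total (+-monoʳ-≤ (f zero) (≤-trans (sum-mono-≤ (f≤m ∘ suc)) (≤-reflexive (sum-const n m)))))
n*m≤sum⇒m≤each {suc n} m f f≤m total (suc i) =
  n*m≤sum⇒m≤each m (f ∘ suc) (f≤m ∘ suc) (+-cancelˡ-≤ m (n * m) _ (≤-trans total (+-monoˡ-≤ _ (f≤m zero)))) i

count : ∀ {n p} {P : Pred (Fin n) p} → Decidable P → ℕ
count {n} P? = ∑[ i < n ] χ (P? i)

count-≥1 : ∀ {n p} {P : Pred (Fin n) p} (P? : Decidable P) {i} → P i → 1 ≤ count P?
count-≥1 P? {zero}  pi = ≤-trans (≤-reflexive (sym (χ-yes (P? zero) pi))) (m≤m+n _ _)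
count-≥1 P? {suc i} pi = ≤-trans (count-≥1 (P? ∘ suc) pi) (m≤n+m _ _)

count-≥2 : ∀ {n p} {P : Pred (Fin n) p} (P? : Decidable P) {i j} → i ≢ j → P i → P j → 2 ≤ count P?
count-≥2 P? {zero}  {zero}  i≢j _  _  = ⊥-elim (i≢j refl)
count-≥2 P? {zero}  {suc j} _   pi pj = +-mono-≤ (≤-reflexive (sym (χ-yes (P? zero) pi))) (count-≥1 (P? ∘ suc) pj)
count-≥2 P? {suc i} {zero}  _   pi pj = +-mono-≤ (≤-reflexive (sym (χ-yes (P? zero) pj))) (count-≥1 (P? ∘ suc) pi)
count-≥2 P? {suc i} {suc j} i≢j pi pj = ≤-trans (count-≥2 (P? ∘ suc) (i≢j ∘ cong suc) pi pj) (m≤n+m _ _)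

count-≡0 : ∀ {n p} {P : Pred (Fin n) p} (P? : Decidable P) → (∀ i → ¬ P i) → count P? ≡ 0
count-≡0 {zero}  P? none = refl
count-≡0 {suc n} P? none = cong₂ _+_ (χ-no (P? zero) (none zero)) (count-≡0 (P? ∘ suc) (none ∘ suc))

count-≤1 : ∀ {n p} {P : Pred (Fin n) p} (P? : Decidable P) → (∀ {i j} → P i → P j → i ≡ j) → count P? ≤ 1
count-≤1 {zero}  P? unique = z≤n
count-≤1 {suc n} P? unique with P? zero
... | yes p0 = ≤-reflexive (cong suc (count-≡0 (P? ∘ suc) (λ i pi → 0≢1+nᶠ (unique p0 pi))))
... | no _   = count-≤1 (P? ∘ suc) (λ pi pj → suc-injectiveᶠ (unique pi pj))

count-⊎ : ∀ {n p q r} {P : Pred (Fin n) p} {Q : Pred (Fin n) q} {R : Pred (Fin n) r}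
  (P? : Decidable P) (Q? : Decidable Q) (R? : Decidable R) →
  (∀ {i} → P i → Q i ⊎ R i) → count P? ≤ count Q? + count R?
count-⊎ {n} P? Q? R? split = ≤-trans (sum-mono-≤ pointwise) (≤-reflexive (∑-distrib-+ (χ ∘ Q?) (χ ∘ R?)))
  where
  pointwise : ∀ i → χ (P? i) ≤ χ (Q? i) + χ (R? i)
  pointwise i with P? i
  ... | no _ = z≤n
  ... | yes pi with split pi
  ...   | inj₁ qi = ≤-trans (≤-reflexive (sym (χ-yes (Q? i) qi))) (m≤m+n _ _)
  ...   | inj₂ ri = ≤-trans (≤-reflexive (sym (χ-yes (R? i) ri))) (m≤n+m _ _)

module _ {n} {P Q : Fin n → Set} {R : Fin n → Fin n → Set}
         (P? : Decidable P) (Q? : Decidable Q) (R? : ∀ w y → Dec (R w y)) where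

  double-counting : ∀ {a b} →
    (∀ {w} → P w → a ≤ count (λ y → Q? y ×-dec R? w y)) →
    (∀ {y} → Q y → count (λ w → P? w ×-dec R? w y) ≤ b) →
    count P? * a ≤ count Q? * b
  double-counting {a} {b} fromP toQ = begin
    count P? * a
      ≡⟨ *-distribʳ-sum a (χ ∘ P?) ⟩
    ∑[ w < n ] (χ (P? w) * a)
      ≤⟨ sum-mono-≤ (λ w → χ*-mono (P? w) fromP) ⟩
    ∑[ w < n ] (χ (P? w) * ∑[ y < n ] χ (Q? y ×-dec R? w y))
      ≡⟨ sum-cong-≗ (λ w → *-distribˡ-sum (χ (P? w)) (λ y → χ (Q? y ×-dec R? w y))) ⟩
    ∑[ w < n ] ∑[ y < n ] (χ (P? w) * χ (Q? y ×-dec R? w y))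
      ≡⟨ ∑-comm (λ w y → χ (P? w) * χ (Q? y ×-dec R? w y)) ⟩
    ∑[ y < n ] ∑[ w < n ] (χ (P? w) * χ (Q? y ×-dec R? w y))
      ≡⟨ sum-cong-≗ (λ y → sum-cong-≗ (λ w → swap-χ (P? w) (Q? y) (R? w y))) ⟩
    ∑[ y < n ] ∑[ w < n ] (χ (Q? y) * χ (P? w ×-dec R? w y))
      ≡⟨ sum-cong-≗ (λ y → *-distribˡ-sum (χ (Q? y)) (λ w → χ (P? w ×-dec R? w y))) ⟨
    ∑[ y < n ] (χ (Q? y) * ∑[ w < n ] χ (P? w ×-dec R? w y))
      ≤⟨ sum-mono-≤ (λ y → χ*-mono (Q? y) toQ) ⟩
    ∑[ y < n ] (χ (Q? y) * b)
      ≡⟨ *-distribʳ-sum b (χ ∘ Q?) ⟨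
    count Q? * b ∎
    where
    open ≤-Reasoning
    swap-χ : ∀ {A B C : Set} (a : Dec A) (b : Dec B) (c : Dec C) → χ a * χ (b ×-dec c) ≡ χ b * χ (a ×-dec c)
    swap-χ a b c = begin-equality
      χ a * χ (b ×-dec c)   ≡⟨ cong (χ a *_) (χ-× b c) ⟩
      χ a * (χ b * χ c)     ≡⟨ *-assoc (χ a) _ _ ⟨
      χ a * χ b * χ c       ≡⟨ cong (_* χ c) (*-comm (χ a) (χ b)) ⟩
      χ b * χ a * χ c       ≡⟨ *-assoc (χ b) _ _ ⟩
      χ b * (χ a * χ c)     ≡⟨ cong (χ b *_) (χ-× a c) ⟨
      χ b * χ (a ×-dec c)   ∎

sumTo-cong : ∀ m {f g : ℕ → ℕ} → (∀ i → i < m → f i ≡ g i) → sumTo m f ≡ sumTo m g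
sumTo-cong zero    f≡g = refl
sumTo-cong (suc m) f≡g = cong₂ _+_ (sumTo-cong m (λ i i<m → f≡g i (m<n⇒m<1+n i<m))) (f≡g m ≤-refl)

sumTo-mono-≤ : ∀ m {f g : ℕ → ℕ} → (∀ i → i < m → f i ≤ g i) → sumTo m f ≤ sumTo m g
sumTo-mono-≤ zero    f≤g = z≤n
sumTo-mono-≤ (suc m) f≤g = +-mono-≤ (sumTo-mono-≤ m (λ i i<m → f≤g i (m<n⇒m<1+n i<m))) (f≤g m ≤-refl)

sumTo-const : ∀ m c → sumTo m (λ _ → c) ≡ m * c
sumTo-const zero    c = refl
sumTo-const (suc m) c = trans (cong (_+ c) (sumTo-const m c)) (+-comm (m * c) c)

sumTo-suc : ∀ m (f : ℕ → ℕ) → sumTo (suc m) f ≡ f 0 + sumTo m (f ∘ suc)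
sumTo-suc zero    f = +-comm 0 (f 0)
sumTo-suc (suc m) f = trans (cong (_+ f (suc m)) (sumTo-suc m f)) (+-assoc (f 0) _ _)

sumTo-∑-comm : ∀ m {n} (F : ℕ → Fin n → ℕ) → sumTo m (λ p → ∑[ v < n ] F p v) ≡ ∑[ v < n ] sumTo m (λ p → F p v)
sumTo-∑-comm zero    {n} F = sym (trans (sum-const n 0) (*-zeroʳ n))
sumTo-∑-comm (suc m)     F = trans (cong (_+ sum (F m)) (sumTo-∑-comm m F)) (sym (∑-distrib-+ _ (F m)))

sumTo-χ-≟ : ∀ x N → sumTo N (λ d → χ (x ≟ d)) ≡ χ (x <? N)
sumTo-χ-≟ x zero    = sym (χ-no (x <? 0) λ ())
sumTo-χ-≟ x (suc N) = trans (cong (_+ χ (x ≟ N)) (sumTo-χ-≟ x N)) last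
  where
  last : χ (x <? N) + χ (x ≟ N) ≡ χ (x <? suc N)
  last with <-cmp x N
  ... | tri< x<N x≢N _ = trans (cong₂ _+_ (χ-yes (x <? N) x<N) (χ-no (x ≟ N) x≢N))
                               (sym (χ-yes (x <? suc N) (m<n⇒m<1+n x<N)))
  ... | tri≈ x≮N x≡N _ = trans (cong₂ _+_ (χ-no (x <? N) x≮N) (χ-yes (x ≟ N) x≡N))
                               (sym (χ-yes (x <? suc N) (s≤s (≤-reflexive x≡N))))
  ... | tri> x≮N x≢N N<x = trans (cong₂ _+_ (χ-no (x <? N) x≮N) (χ-no (x ≟ N) x≢N))
                               (sym (χ-no (x <? suc N) (λ x<1+N → <-irrefl refl (≤-trans N<x (≤-pred x<1+N)))))

sumTo-window : ∀ N L (f : ℕ → ℕ) → (∀ s → f s ≤ 1) → (∀ s → L ≤ s → s < N → f s ≡ 0) → sumTo N f ≤ L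
sumTo-window N L f f≤1 vanish = ≤-trans (bounded N vanish) (m⊓n≤n N L)
  where
  bounded : ∀ M → (∀ s → L ≤ s → s < M → f s ≡ 0) → sumTo M f ≤ M ⊓ L
  bounded zero    _      = z≤n
  bounded (suc M) vanish with M <? L
  ... | yes M<L = ≤-trans (+-mono-≤ (bounded M (λ s L≤s s<M → vanish s L≤s (m<n⇒m<1+n s<M))) (f≤1 M))
                          (≤-reflexive (trans (cong (_+ 1) (m≤n⇒m⊓n≡m (<⇒≤ M<L)))
                                              (trans (+-comm M 1) (sym (m≤n⇒m⊓n≡m M<L)))))
  ... | no M≮L = ≤-trans (+-mono-≤ (bounded M (λ s L≤s s<M → vanish s L≤s (m<n⇒m<1+n s<M)))
                                    (≤-reflexive (vanish M (≮⇒≥ M≮L) ≤-refl)))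
                          (≤-reflexive (trans (+-identityʳ _)
                             (trans (m≥n⇒m⊓n≡n (≮⇒≥ M≮L)) (sym (m≥n⇒m⊓n≡n (m≤n⇒m≤1+n (≮⇒≥ M≮L)))))))

sumTo-shift : ∀ m (f : ℕ → ℕ) → sumTo m (f ∘ suc) + f 0 ≡ sumTo m f + f m
sumTo-shift zero    f = refl
sumTo-shift (suc m) f = begin
  sumTo m (f ∘ suc) + f (suc m) + f 0     ≡⟨ +-assoc (sumTo m (f ∘ suc)) _ _ ⟩
  sumTo m (f ∘ suc) + (f (suc m) + f 0)   ≡⟨ cong (sumTo m (f ∘ suc) +_) (+-comm (f (suc m)) (f 0)) ⟩
  sumTo m (f ∘ suc) + (f 0 + f (suc m))   ≡⟨ +-assoc (sumTo m (f ∘ suc)) _ _ ⟨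
  sumTo m (f ∘ suc) + f 0 + f (suc m)     ≡⟨ cong (_+ f (suc m)) (sumTo-shift m f) ⟩
  sumTo m f + f m + f (suc m)             ∎
  where open ≡-Reasoning

sumTo-rotate : ∀ q (f : ℕ → ℕ) → (∀ p → f (p + q) ≡ f p) → ∀ c → sumTo q (λ s → f (c + s)) ≡ sumTo q f
sumTo-rotate q f periodic zero    = refl
sumTo-rotate q f periodic (suc c) = begin
  sumTo q (λ s → f (suc c + s))   ≡⟨ sumTo-cong q (λ s _ → cong f (sym (+-suc c s))) ⟩
  sumTo q (λ s → f (c + suc s))   ≡⟨ +-cancelʳ-≡ (f (c + 0)) _ _ shifted ⟩
  sumTo q (λ s → f (c + s))       ≡⟨ sumTo-rotate q f periodic c ⟩
  sumTo q f                       ∎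
  where
  open ≡-Reasoning
  shifted : sumTo q (λ s → f (c + suc s)) + f (c + 0) ≡ sumTo q (λ s → f (c + s)) + f (c + 0)
  shifted = trans (sumTo-shift q (λ s → f (c + s)))
                  (cong (sumTo q (λ s → f (c + s)) +_) (trans (periodic c) (cong f (sym (+-identityʳ c)))))

-- The least n < N with P n, or N if there is none.
least : ∀ {p} {P : Pred ℕ p} → Decidable P → ℕ → ℕ
least P? zero    = zero
least P? (suc N) with P? zero
... | yes _ = zero
... | no  _ = suc (least (P? ∘ suc) N)

least-found : ∀ {p} {P : Pred ℕ p} (P? : Decidable P) N → least P? N < N → P (least P? N)
least-found P? (suc N) l<N with P? zero
... | yes p0 = p0
... | no  _  = least-found (P? ∘ suc) N (≤-pred l<N)

least-minimal : ∀ {p} {P : Pred ℕ p} (P? : Decidable P) N {m} → P m → m < N → least P? N ≤ m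
least-minimal P? (suc N) {m} pm m<N with P? zero
... | yes _ = z≤n
least-minimal P? (suc N) {zero}  pm _   | no ¬p0 = ⊥-elim (¬p0 pm)
least-minimal P? (suc N) {suc m} pm m<N | no _   = s≤s (least-minimal (P? ∘ suc) N pm (≤-pred m<N))

module _ {n : ℕ} (G : Graph n) where

  Adj : Fin n → Fin n → Set
  Adj u v = adj G u v ≡ true

  Adj? : ∀ u v → Dec (Adj u v)
  Adj? u v = adj G u v ≟ᵇ true

  degree≡count : ∀ v → degree G v ≡ count (Adj? v)
  degree≡count v = trans (listSum-allFin (λ y → if adj G v y then 1 else 0)) (sum-cong-≗ (λ y → χ-if (adj G v y)))

  Adj-sym : ∀ {u v} → Adj u v → Adj v u
  Adj-sym {u} {v} a = trans (Graph.sym G v u) a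

  Adj⇒≢ : ∀ {u v} → Adj u v → u ≢ v
  Adj⇒≢ {u} a refl with trans (sym a) (irrefl G u)
  ... | ()

module _ {n} {G : Graph n} where

  snoc : ∀ {u v w ℓ} → Walk G u v ℓ → Adj G v w → Walk G u w (suc ℓ)
  snoc nil        a = cons a nil
  snoc (cons b W) a = cons b (snoc W a)

  _++_ : ∀ {u v w ℓ ℓ′} → Walk G u v ℓ → Walk G v w ℓ′ → Walk G u w (ℓ + ℓ′)
  nil      ++ W = W
  cons a V ++ W = cons a (V ++ W)

  reverse : ∀ {u v ℓ} → Walk G u v ℓ → Walk G v u ℓ
  reverse nil        = nil
  reverse (cons a W) = snoc (reverse W) (Adj-sym G a)

  unsnoc : ∀ {u w ℓ} → Walk G u w (suc ℓ) → ∃[ v ] (Walk G u v ℓ × Adj G v w)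
  unsnoc W with reverse W
  ... | cons a V = _ , reverse V , Adj-sym G a

module _ {n : ℕ} (G : Graph n) where

  InBall-refl : ∀ {d u} → InBall G d u u
  InBall-refl = 0 , z≤n , nil

  InBall-mono : ∀ {d d′ u v} → d ≤ d′ → InBall G d u v → InBall G d′ u v
  InBall-mono d≤d′ (ℓ , ℓ≤d , W) = ℓ , ≤-trans ℓ≤d d≤d′ , W

  InBall-zero : ∀ {u v} → InBall G 0 u v → u ≡ v
  InBall-zero (zero , _ , nil) = refl

  InBall-snoc : ∀ {d u v w} → InBall G d u v → Adj G v w → InBall G (suc d) u w
  InBall-snoc (ℓ , ℓ≤d , W) a = suc ℓ , s≤s ℓ≤d , snoc W a

  InBall-unsnoc : ∀ {d u w} → InBall G (suc d) u w → u ≡ w ⊎ ∃[ v ] (InBall G d u v × Adj G v w)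
  InBall-unsnoc (zero  , _         , nil) = inj₁ refl
  InBall-unsnoc (suc ℓ , s≤s ℓ≤d , W) with unsnoc W
  ... | v , V , a = inj₂ (v , (ℓ , ℓ≤d , V) , a)

  InBall? : ∀ d u v → Dec (InBall G d u v)
  InBall? zero    u v = map′ (λ { refl → InBall-refl }) InBall-zero (u ≟ᶠ v)
  InBall? (suc d) u v = map′ fromStep toStep (u ≟ᶠ v ⊎-dec any? (λ w → Adj? G u w ×-dec InBall? d w v))
    where
    fromStep : u ≡ v ⊎ ∃[ w ] (Adj G u w × InBall G d w v) → InBall G (suc d) u v
    fromStep (inj₁ refl)                   = InBall-refl
    fromStep (inj₂ (w , a , ℓ , ℓ≤d , W)) = suc ℓ , s≤s ℓ≤d , cons a W
    toStep : InBall G (suc d) u v → u ≡ v ⊎ ∃[ w ] (Adj G u w × InBall G d w v)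
    toStep (zero  , _         , nil)      = inj₁ refl
    toStep (suc ℓ , s≤s ℓ≤d , cons a W) = inj₂ (_ , a , ℓ , ℓ≤d , W)

  record IsPath (m : ℕ) (P : ℕ → Fin n) : Set where
    field
      injective : ∀ {s t} → s ≤ m → t ≤ m → P s ≡ P t → s ≡ t
      adjacent  : ∀ {s} → s < m → Adj G (P s) (P (suc s))

  closedPath⇒Cycle : ∀ {m P} → IsPath m P → Adj G (P m) (P 0) → 2 ≤ m → Cycle G (suc m)
  closedPath⇒Cycle {m} {P} path closing 2≤m = record
    { len≥3 = s≤s 2≤m
    ; vert  = λ i → P (toℕ i)
    ; inj   = λ {i} {j} eq → toℕ-injective (injective (≤-pred (toℕ<n i)) (≤-pred (toℕ<n j)) eq)
    ; edges = λ i → subst (λ s → Adj G (P (toℕ i)) (P s)) (sym (toℕ-fromℕ< _)) (edgeAt (toℕ i) (≤-pred (toℕ<n i)))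
    }
    where
    open IsPath path
    edgeAt : ∀ s → s ≤ m → Adj G (P s) (P ((s + 1) % suc m))
    edgeAt s s≤m with m≤n⇒m<n∨m≡n s≤m
    ... | inj₁ s<m  = subst (λ t → Adj G (P s) (P t))
                            (sym (trans (m<n⇒m%n≡m (s≤s (≤-trans (≤-reflexive (+-comm s 1)) s<m))) (+-comm s 1)))
                            (adjacent s<m)
    ... | inj₂ refl = subst (λ t → Adj G (P s) (P t)) (sym (trans (cong (_% suc s) (+-comm s 1)) (n%n≡0 (suc s)))) closing

  IsPath-≤ : ∀ {m m′ P} → m′ ≤ m → IsPath m P → IsPath m′ P
  IsPath-≤ m′≤m path = record
    { injective = λ s≤m′ t≤m′ → injective (≤-trans s≤m′ m′≤m) (≤-trans t≤m′ m′≤m)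
    ; adjacent  = λ s<m′ → adjacent (≤-trans s<m′ m′≤m)
    }
    where open IsPath path

  -- The vertex sequence P 0, …, P a, Q b, …, Q 0.
  splice : ℕ → ℕ → (ℕ → Fin n) → (ℕ → Fin n) → ℕ → Fin n
  splice a b P Q s with s ≤? a
  ... | yes _ = P s
  ... | no  _ = Q (a + suc b ∸ s)

  module _ {a b P Q} (pathP : IsPath a P) (pathQ : IsPath b Q)
           (disjoint : ∀ {s t} → s ≤ a → t ≤ b → P s ≢ Q t) (junction : Adj G (P a) (Q b)) where

    private
      mirror≤b : ∀ {s} → a < s → a + suc b ∸ s ≤ b
      mirror≤b {s} a<s = ≤-trans (∸-monoʳ-≤ (a + suc b) a<s) (≤-reflexive (trans (cong (_∸ suc a) (+-suc a b)) (m+n∸m≡n (suc a) b)))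

    splice-isPath : IsPath (a + suc b) (splice a b P Q)
    splice-isPath = record { injective = injective ; adjacent = adjacent }
      where
      module P = IsPath pathP
      module Q = IsPath pathQ
      injective : ∀ {s t} → s ≤ a + suc b → t ≤ a + suc b → splice a b P Q s ≡ splice a b P Q t → s ≡ t
      injective {s} {t} s≤ t≤ eq with s ≤? a | t ≤? a
      ... | yes s≤a | yes t≤a = P.injective s≤a t≤a eq
      ... | yes s≤a | no  t≰a = ⊥-elim (disjoint s≤a (mirror≤b (≰⇒> t≰a)) eq)
      ... | no  s≰a | yes t≤a = ⊥-elim (disjoint t≤a (mirror≤b (≰⇒> s≰a)) (sym eq))
      ... | no  s≰a | no  t≰a = ∸-cancelˡ-≡ s≤ t≤ (Q.injective (mirror≤b (≰⇒> s≰a)) (mirror≤b (≰⇒> t≰a)) eq)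
      adjacent : ∀ {s} → s < a + suc b → Adj G (splice a b P Q s) (splice a b P Q (suc s))
      adjacent {s} s< with s ≤? a | suc s ≤? a
      ... | yes _   | yes s<a = P.adjacent s<a
      ... | yes s≤a | no  s≮a with ≤-antisym s≤a (≤-pred (≰⇒> s≮a))
      ...   | refl = subst (λ t → Adj G (P s) (Q t)) (sym (trans (cong (_∸ suc s) (+-suc s b)) (m+n∸m≡n (suc s) b))) junction
      adjacent {s} s< | no s≰a | yes s<a = ⊥-elim (s≰a (≤-trans (n≤1+n s) s<a))
      adjacent {s} s< | no s≰a | no  _   = subst (λ t → Adj G (Q t) (Q (a + suc b ∸ suc s))) (sym (m∸n≡1+[m∸1+n] s<))
        (Adj-sym G (Q.adjacent (subst (_≤ b) (m∸n≡1+[m∸1+n] s<) (mirror≤b (≰⇒> s≰a)))))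

    twoPaths⇒Cycle : Adj G (Q 0) (P 0) → 1 ≤ a + b → Cycle G (suc (a + suc b))
    twoPaths⇒Cycle closing 1≤a+b =
      closedPath⇒Cycle splice-isPath (subst₂ (Adj G) (sym last) (sym first) closing)
                       (≤-trans (s≤s 1≤a+b) (≤-reflexive (sym (+-suc a b))))
      where
      first : splice a b P Q 0 ≡ P 0
      first with 0 ≤? a
      ... | yes _  = refl
      ... | no 0≰a = ⊥-elim (0≰a z≤n)
      last : splice a b P Q (a + suc b) ≡ Q 0
      last with a + suc b ≤? a
      ... | yes a+b<a = ⊥-elim (1+n≰n (≤-trans (≤-trans (s≤s (m≤m+n a b)) (≤-reflexive (sym (+-suc a b)))) a+b<a))
      ... | no  _     = cong Q (n∸n≡0 (a + suc b))

-- The centre of a Moore tree: a vertex for odd girth (e = 0), an edge for even girth (e = 1).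
data Root {n} (G : Graph n) : ℕ → Fin n → Fin n → Set where
  vertex : ∀ {r} → Root G 0 r r
  edge   : ∀ {r₁ r₂} → Adj G r₁ r₂ → Root G 1 r₁ r₂

module _ {n} {G : Graph n} where

  roots-adjacent : ∀ {e r₁ r₂ u v} → Root G e r₁ r₂ → u ≡ r₁ ⊎ u ≡ r₂ → v ≡ r₁ ⊎ v ≡ r₂ → u ≢ v →
                   e ≡ 1 × Adj G u v
  roots-adjacent vertex   (inj₁ refl) (inj₁ refl) u≢v = ⊥-elim (u≢v refl)
  roots-adjacent vertex   (inj₁ refl) (inj₂ refl) u≢v = ⊥-elim (u≢v refl)
  roots-adjacent vertex   (inj₂ refl) (inj₁ refl) u≢v = ⊥-elim (u≢v refl)
  roots-adjacent vertex   (inj₂ refl) (inj₂ refl) u≢v = ⊥-elim (u≢v refl)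
  roots-adjacent (edge a) (inj₁ refl) (inj₁ refl) u≢v = ⊥-elim (u≢v refl)
  roots-adjacent (edge a) (inj₁ refl) (inj₂ refl) _   = refl , a
  roots-adjacent (edge a) (inj₂ refl) (inj₁ refl) _   = refl , Adj-sym G a
  roots-adjacent (edge a) (inj₂ refl) (inj₂ refl) u≢v = ⊥-elim (u≢v refl)

module Levels {n} {G : Graph n} {e r₁ r₂} (root : Root G e r₁ r₂) (K : ℕ) where

  NearRoot : ℕ → Fin n → Set
  NearRoot d v = InBall G d r₁ v ⊎ InBall G d r₂ v

  NearRoot? : ∀ d v → Dec (NearRoot d v)
  NearRoot? d v = InBall? G d r₁ v ⊎-dec InBall? G d r₂ v

  -- The distance to the root, or suc K if that exceeds K.
  level : Fin n → ℕ
  level v = least (λ d → NearRoot? d v) (suc K)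

  level-near : ∀ {v} → level v ≤ K → NearRoot (level v) v
  level-near {v} l≤K = least-found (λ d → NearRoot? d v) (suc K) (s≤s l≤K)

  level-minimal : ∀ {d v} → NearRoot d v → d ≤ K → level v ≤ d
  level-minimal {v = v} near d≤K = least-minimal (λ d → NearRoot? d v) (suc K) near (s≤s d≤K)

  NearRoot-mono : ∀ {d d′ v} → d ≤ d′ → NearRoot d v → NearRoot d′ v
  NearRoot-mono d≤d′ (inj₁ near) = inj₁ (InBall-mono G d≤d′ near)
  NearRoot-mono d≤d′ (inj₂ near) = inj₂ (InBall-mono G d≤d′ near)

  level-r₁ : level r₁ ≡ 0
  level-r₁ = n≤0⇒n≡0 (level-minimal (inj₁ (InBall-refl G)) z≤n)

  level-r₂ : level r₂ ≡ 0
  level-r₂ = n≤0⇒n≡0 (level-minimal (inj₂ (InBall-refl G)) z≤n)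

  level≡0⇒root : ∀ {v} → level v ≡ 0 → v ≡ r₁ ⊎ v ≡ r₂
  level≡0⇒root {v} l≡0 with subst (λ d → NearRoot d v) l≡0 (level-near (subst (_≤ K) (sym l≡0) z≤n))
  ... | inj₁ near = inj₁ (sym (InBall-zero G near))
  ... | inj₂ near = inj₂ (sym (InBall-zero G near))

  level-adj : ∀ {w y} → Adj G w y → level w < K → level y ≤ suc (level w)
  level-adj {w} a l<K with level-near (<⇒≤ l<K)
  ... | inj₁ near = level-minimal (inj₁ (InBall-snoc G near a)) l<K
  ... | inj₂ near = level-minimal (inj₂ (InBall-snoc G near a)) l<K

  NearRoot-unsnoc : ∀ {d y} → NearRoot (suc d) y → level y ≡ 0 ⊎ ∃[ w ] (NearRoot d w × Adj G w y)
  NearRoot-unsnoc (inj₁ near) with InBall-unsnoc G near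
  ... | inj₁ refl           = inj₁ level-r₁
  ... | inj₂ (w , near′ , a) = inj₂ (w , inj₁ near′ , a)
  NearRoot-unsnoc (inj₂ near) with InBall-unsnoc G near
  ... | inj₁ refl           = inj₁ level-r₂
  ... | inj₂ (w , near′ , a) = inj₂ (w , inj₂ near′ , a)

  lower-neighbour : ∀ {y d} → level y ≡ suc d → suc d ≤ K → ∃[ w ] (Adj G w y × level w ≡ d)
  lower-neighbour {y} {d} ly≡1+d 1+d≤K
    with NearRoot-unsnoc (subst (λ l → NearRoot l y) ly≡1+d (level-near (subst (_≤ K) (sym ly≡1+d) 1+d≤K)))
  ... | inj₁ ly≡0 = ⊥-elim (0≢1+n (trans (sym ly≡0) ly≡1+d))
  ... | inj₂ (w , near , a) = w , a , ≤-antisym lw≤d d≤lw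
    where
    lw≤d : level w ≤ d
    lw≤d = level-minimal near (≤-trans (n≤1+n d) 1+d≤K)
    d≤lw : d ≤ level w
    d≤lw = ≤-pred (subst (_≤ suc (level w)) ly≡1+d (level-adj a (≤-trans (s≤s lw≤d) 1+d≤K)))

  parent : Fin n → Fin n
  parent y with any? (λ w → Adj? G w y ×-dec (suc (level w) ≟ level y))
  ... | yes (w , _) = w
  ... | no  _       = y

  parent-spec : ∀ {y d} → level y ≡ suc d → suc d ≤ K → Adj G (parent y) y × level (parent y) ≡ d
  parent-spec {y} {d} ly≡1+d 1+d≤K with any? (λ w → Adj? G w y ×-dec (suc (level w) ≟ level y))
  ... | yes (w , a , 1+lw≡ly) = a , suc-injective (trans 1+lw≡ly ly≡1+d)
  ... | no  none with lower-neighbour ly≡1+d 1+d≤K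
  ...   | w , a , lw≡d = ⊥-elim (none (w , a , trans (cong suc lw≡d) (sym ly≡1+d)))

  ancestor : ℕ → Fin n → Fin n
  ancestor zero    y = y
  ancestor (suc i) y = parent (ancestor i y)

  module _ {y} (ly≤K : level y ≤ K) where

    ancestor-level : ∀ {i} → i ≤ level y → level (ancestor i y) ≡ level y ∸ i
    ancestor-step  : ∀ {i} → i < level y → Adj G (ancestor (suc i) y) (ancestor i y) × level (ancestor (suc i) y) ≡ level y ∸ suc i

    ancestor-level {zero}  _    = refl
    ancestor-level {suc i} i<ly = proj₂ (ancestor-step i<ly)

    ancestor-step {i} i<ly = parent-spec (trans (ancestor-level (<⇒≤ i<ly)) (m∸n≡1+[m∸1+n] i<ly))
      (≤-trans (≤-reflexive (sym (m∸n≡1+[m∸1+n] i<ly))) (≤-trans (m∸n≤m (level y) i) ly≤K))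

    ancestors-isPath : IsPath G (level y) (λ i → ancestor i y)
    ancestors-isPath = record
      { injective = λ s≤ t≤ eq → ∸-cancelˡ-≡ s≤ t≤ (trans (sym (ancestor-level s≤)) (trans (cong level eq) (ancestor-level t≤)))
      ; adjacent  = λ s< → Adj-sym G (proj₁ (ancestor-step s<))
      }

  descent : Fin n → Fin n → ℕ → Fin n
  descent w x zero    = w
  descent w x (suc i) = ancestor i x

  module _ {w x} (wx : Adj G w x) (lx≤lw : level x ≤ level w) (lw≤K : level w ≤ K) where

    private
      lx≤K = ≤-trans lx≤lw lw≤K
      module A = IsPath (ancestors-isPath lx≤K)

    not-ancestor : ∀ {t} → t ≤ level x → w ≢ ancestor t x
    not-ancestor {zero}  _     w≡x = Adj⇒≢ G wx w≡x
    not-ancestor {suc t} t<lx  w≡a = <⇒≱ (≤-trans deeper lx≤lw) (≤-reflexive (cong level w≡a))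
      where
      deeper : level (ancestor (suc t) x) < level x
      deeper = subst (_< level x) (sym (ancestor-level lx≤K t<lx)) (∸-monoʳ-< {o = 0} (s≤s z≤n) t<lx)

    descent-isPath : IsPath G (suc (level x)) (descent w x)
    descent-isPath = record { injective = injective ; adjacent = adjacent }
      where
      injective : ∀ {s t} → s ≤ suc (level x) → t ≤ suc (level x) → descent w x s ≡ descent w x t → s ≡ t
      injective {zero}  {zero}  _   _   _  = refl
      injective {zero}  {suc t} _   t≤  eq = ⊥-elim (not-ancestor (≤-pred t≤) eq)
      injective {suc s} {zero}  s≤  _   eq = ⊥-elim (not-ancestor (≤-pred s≤) (sym eq))
      injective {suc s} {suc t} s≤  t≤  eq = cong suc (A.injective (≤-pred s≤) (≤-pred t≤) eq)
      adjacent : ∀ {s} → s < suc (level x) → Adj G (descent w x s) (descent w x (suc s))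
      adjacent {zero}  _  = wx
      adjacent {suc s} s< = A.adjacent (≤-pred s<)

  -- Follow parents from x and from x′ down to the first vertex the two chains share; with w they
  -- close a cycle. If they never meet they end at the two ends of the root edge, closing it there.
  module _ {w x x′} (wx : Adj G w x) (wx′ : Adj G w x′) (x≢x′ : x ≢ x′)
           (lx≤lw : level x ≤ level w) (lx′≤lw : level x′ ≤ level w) (lw≤K : level w ≤ K) where

    private
      a = level x
      b = level x′
      X = λ i → ancestor i x
      Y = λ j → ancestor j x′
      pathX = ancestors-isPath (≤-trans lx≤lw lw≤K)
      pathY = ancestors-isPath (≤-trans lx′≤lw lw≤K)
      pathQ = descent-isPath wx′ lx′≤lw lw≤K
      module Y = IsPath pathY
      module Q = IsPath pathQ

      Meet : ℕ → Set
      Meet i = ∃ λ j → j < suc b × X i ≡ Y j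

      Meet? : ∀ i → Dec (Meet i)
      Meet? i = anyUpTo? (λ j → X i ≟ᶠ Y j) (suc b)

      α = least Meet? (suc a)

      X≢w : ∀ {s} → s ≤ a → X s ≢ w
      X≢w s≤a eq = not-ancestor wx lx≤lw lw≤K s≤a (sym eq)

      cycle-bound : ∀ {α β} → α ≤ a → β ≤ b → suc (α + suc β) ≤ suc (suc (a + b + e))
      cycle-bound α≤a β≤b = s≤s (≤-trans (≤-reflexive (+-suc _ _)) (s≤s (≤-trans (+-mono-≤ α≤a β≤b) (m≤m+n (a + b) e))))

      meeting : α ≤ a → Meet α → ∃[ m ] (Cycle G m × m ≤ suc (suc (a + b + e)))
      meeting α≤a (β , β<1+b , Xα≡Yβ) =
        _ , twoPaths⇒Cycle G (IsPath-≤ G α≤a pathX) (IsPath-≤ G (m≤n⇒m≤1+n (≤-pred β<1+b)) pathQ) disjoint junction wx nonempty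
          , cycle-bound α≤a (≤-pred β<1+b)
        where
        disjoint : ∀ {s t} → s ≤ α → t ≤ β → X s ≢ descent w x′ t
        disjoint {s} {zero}  s≤α _   eq = X≢w (≤-trans s≤α α≤a) eq
        disjoint {s} {suc t} s≤α t<β eq with m≤n⇒m<n∨m≡n s≤α
        ... | inj₁ s<α  = <⇒≱ s<α (least-minimal Meet? (suc a) (t , m≤n⇒m≤1+n (≤-trans t<β (≤-pred β<1+b)) , eq)
                                                    (s≤s (≤-trans (<⇒≤ s<α) α≤a)))
        ... | inj₂ refl = <⇒≢ t<β (Y.injective (≤-trans (<⇒≤ t<β) (≤-pred β<1+b)) (≤-pred β<1+b) (trans (sym eq) Xα≡Yβ))
        junction : Adj G (X α) (descent w x′ β)
        junction = subst (λ z → Adj G z (descent w x′ β)) (sym Xα≡Yβ) (Adj-sym G (Q.adjacent β<1+b))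
        nonempty : 1 ≤ α + β
        nonempty = positive α β Xα≡Yβ
          where
          positive : ∀ i j → X i ≡ Y j → 1 ≤ i + j
          positive zero    zero    x≡x′ = ⊥-elim (x≢x′ x≡x′)
          positive zero    (suc j) _    = s≤s z≤n
          positive (suc i) j       _    = s≤s z≤n

      no-meeting : (∀ {i} → i ≤ a → ¬ Meet i) → ∃[ m ] (Cycle G m × m ≤ suc (suc (a + b + e)))
      no-meeting apart with roots-adjacent root (level≡0⇒root Xa≡0) (level≡0⇒root Yb≡0) (λ eq → apart ≤-refl (b , ≤-refl , eq))
        where
        Xa≡0 : level (X a) ≡ 0
        Xa≡0 = trans (ancestor-level (≤-trans lx≤lw lw≤K) ≤-refl) (n∸n≡0 a)
        Yb≡0 : level (Y b) ≡ 0
        Yb≡0 = trans (ancestor-level (≤-trans lx′≤lw lw≤K) ≤-refl) (n∸n≡0 b)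
      ... | refl , junction =
        _ , twoPaths⇒Cycle G pathX pathQ disjoint junction wx (≤-trans (s≤s z≤n) (≤-reflexive (sym (+-suc a b))))
          , ≤-reflexive (cong suc (trans (+-suc a (suc b)) (cong suc (trans (+-suc a b) (+-comm 1 (a + b))))))
        where
        disjoint : ∀ {s t} → s ≤ a → t ≤ suc b → X s ≢ descent w x′ t
        disjoint {s} {zero}  s≤a _   eq = X≢w s≤a eq
        disjoint {s} {suc t} s≤a t≤b eq = apart s≤a (t , t≤b , eq)

    shortCycle : ∃[ m ] (Cycle G m × m ≤ suc (suc (level x + level x′ + e)))
    shortCycle with α <? suc a
    ... | yes α<1+a = meeting (≤-pred α<1+a) (least-found Meet? (suc a) α<1+a)
    ... | no  α≮1+a = no-meeting (λ i≤a meet → α≮1+a (s≤s (≤-trans (least-minimal Meet? (suc a) meet (s≤s i≤a)) i≤a)))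

module MooreTree {n} {G : Graph n} {e r₁ r₂} (root : Root G e r₁ r₂) (K : ℕ)
  (girth : ∀ {m} → Cycle G m → suc (K + K + e) ≤ m) {δ} (minDegree : ∀ v → δ ≤ degree G v) where

  open Levels root K

  lower-neighbour-unique : ∀ {d w x x′} → d < K → level w ≤ K → Adj G w x → Adj G w x′ →
    level x ≤ d → level x′ ≤ d → level x ≤ level w → level x′ ≤ level w → x ≡ x′
  lower-neighbour-unique {d} {w} {x} {x′} d<K lw≤K wx wx′ lx≤d lx′≤d lx≤lw lx′≤lw with x ≟ᶠ x′
  ... | yes x≡x′ = x≡x′
  ... | no  x≢x′ with shortCycle wx wx′ x≢x′ lx≤lw lx′≤lw lw≤K
  ...   | m , C , m≤ = ⊥-elim (<⇒≱ too-short (girth C))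
    where
    too-short : m < suc (K + K + e)
    too-short = s≤s (≤-trans m≤ (≤-trans (s≤s (s≤s (+-monoˡ-≤ e (+-mono-≤ lx≤d lx′≤d))))
                  (+-monoˡ-≤ e (≤-trans (≤-reflexive (cong suc (sym (+-suc d d)))) (+-mono-≤ d<K d<K)))))

  layer : ℕ → ℕ
  layer d = count (λ v → level v ≟ d)

  upward : ℕ → Fin n → ℕ
  upward d w = count (λ y → (level y ≟ suc d) ×-dec Adj? G w y)

  downward : ℕ → Fin n → ℕ
  downward d w = count (λ y → (level y ≤? d) ×-dec Adj? G w y)

  degree≤upward+downward : ∀ {w d} → level w ≡ d → d < K → δ ≤ upward d w + downward d w
  degree≤upward+downward {w} {d} lw≡d d<K = ≤-trans (minDegree w) (≤-trans (≤-reflexive (degree≡count G w))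
    (count-⊎ (Adj? G w) (λ y → (level y ≟ suc d) ×-dec Adj? G w y) (λ y → (level y ≤? d) ×-dec Adj? G w y) split))
    where
    split : ∀ {y} → Adj G w y → (level y ≡ suc d × Adj G w y) ⊎ (level y ≤ d × Adj G w y)
    split {y} a with m≤n⇒m<n∨m≡n (subst (λ l → level y ≤ suc l) lw≡d (level-adj a (subst (_< K) (sym lw≡d) d<K)))
    ... | inj₁ ly<1+d  = inj₂ (≤-pred ly<1+d , a)
    ... | inj₂ ly≡1+d = inj₁ (ly≡1+d , a)

  downward-≤1 : ∀ {w d} → level w ≡ d → d < K → downward d w ≤ 1
  downward-≤1 {w} {d} lw≡d d<K = count-≤1 (λ y → (level y ≤? d) ×-dec Adj? G w y)
    λ (ly≤d , a) (ly′≤d , a′) → lower-neighbour-unique d<K (subst (_≤ K) (sym lw≡d) (<⇒≤ d<K)) a a′ ly≤d ly′≤d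
      (subst (_ ≤_) (sym lw≡d) ly≤d) (subst (_ ≤_) (sym lw≡d) ly′≤d)

  downward-centre : r₁ ≡ r₂ → ∀ {w} → level w ≡ 0 → downward 0 w ≤ 0
  downward-centre r₁≡r₂ {w} lw≡0 = ≤-reflexive (count-≡0 (λ y → (level y ≤? 0) ×-dec Adj? G w y)
    λ y (ly≤0 , a) → Adj⇒≢ G a (trans (centre lw≡0) (sym (centre (n≤0⇒n≡0 ly≤0)))))
    where
    centre : ∀ {v} → level v ≡ 0 → v ≡ r₂
    centre lv≡0 with level≡0⇒root lv≡0
    ... | inj₁ v≡r₁ = trans v≡r₁ r₁≡r₂
    ... | inj₂ v≡r₂ = v≡r₂

  parents-≤1 : ∀ {y d} → level y ≡ suc d → suc d ≤ K → count (λ w → (level w ≟ d) ×-dec Adj? G w y) ≤ 1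
  parents-≤1 {y} {d} ly≡1+d 1+d≤K = count-≤1 (λ w → (level w ≟ d) ×-dec Adj? G w y)
    λ (lw≡d , a) (lw′≡d , a′) → lower-neighbour-unique {d} 1+d≤K (subst (_≤ K) (sym ly≡1+d) 1+d≤K)
      (Adj-sym G a) (Adj-sym G a′) (≤-reflexive lw≡d) (≤-reflexive lw′≡d)
      (≤-trans (≤-reflexive lw≡d) (≤-trans (n≤1+n d) (≤-reflexive (sym ly≡1+d))))
      (≤-trans (≤-reflexive lw′≡d) (≤-trans (n≤1+n d) (≤-reflexive (sym ly≡1+d))))

  layer-growth : ∀ {d c} → d < K → (∀ {w} → level w ≡ d → downward d w ≤ c) → layer d * (δ ∸ c) ≤ layer (suc d)
  layer-growth {d} {c} d<K downward≤c =
    ≤-trans (double-counting (λ w → level w ≟ d) (λ y → level y ≟ suc d) (Adj? G) from-layer to-layer)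
            (≤-reflexive (*-identityʳ (layer (suc d))))
    where
    from-layer : ∀ {w} → level w ≡ d → δ ∸ c ≤ upward d w
    from-layer {w} lw≡d = begin
      δ ∸ c                                  ≤⟨ ∸-monoʳ-≤ δ (downward≤c lw≡d) ⟩
      δ ∸ downward d w                       ≤⟨ ∸-monoˡ-≤ (downward d w) (degree≤upward+downward lw≡d d<K) ⟩
      upward d w + downward d w ∸ downward d w ≡⟨ m+n∸n≡m (upward d w) (downward d w) ⟩
      upward d w                             ∎
      where open ≤-Reasoning
    to-layer : ∀ {y} → level y ≡ suc d → count (λ w → (level w ≟ d) ×-dec Adj? G w y) ≤ 1
    to-layer ly≡1+d = parents-≤1 ly≡1+d d<K

  ball≡layers : count (NearRoot? K) ≡ sumTo (suc K) layer
  ball≡layers = trans (sum-cong-≗ pointwise) (sym (sumTo-∑-comm (suc K) (λ d v → χ (level v ≟ d))))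
    where
    pointwise : ∀ v → χ (NearRoot? K v) ≡ sumTo (suc K) (λ d → χ (level v ≟ d))
    pointwise v = trans (χ-cong (λ near → s≤s (level-minimal near ≤-refl))
                                (λ l<1+K → NearRoot-mono (≤-pred l<1+K) (level-near (≤-pred l<1+K)))
                                (NearRoot? K v) (level v <? suc K))
                        (sym (sumTo-χ-≟ (level v) (suc K)))

  private
    x*[y*z]≡x*z*y : ∀ x y z → x * (y * z) ≡ x * z * y
    x*[y*z]≡x*z*y x y z = trans (cong (x *_) (*-comm y z)) (sym (*-assoc x z y))

  module _ (r₁≡r₂ : r₁ ≡ r₂) where

    layer0≥1 : 1 ≤ layer 0
    layer0≥1 = count-≥1 (λ v → level v ≟ 0) level-r₁

    vertex-layers : ∀ {d} → d < K → δ * pow (δ ∸ 1) d ≤ layer (suc d)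
    vertex-layers {zero}  0<K = ≤-trans (≤-reflexive (*-comm δ 1))
      (≤-trans (*-monoˡ-≤ δ layer0≥1) (layer-growth 0<K (downward-centre r₁≡r₂)))
    vertex-layers {suc d} d<K = ≤-trans (≤-reflexive (x*[y*z]≡x*z*y δ (δ ∸ 1) (pow (δ ∸ 1) d)))
      (≤-trans (*-monoˡ-≤ (δ ∸ 1) (vertex-layers (≤-trans (n≤1+n (suc d)) d<K)))
               (layer-growth d<K (λ lw≡ → downward-≤1 lw≡ d<K)))

    vertex-moore : 1 + sumTo K (λ i → δ * pow (δ ∸ 1) i) ≤ count (NearRoot? K)
    vertex-moore = ≤-trans (+-mono-≤ layer0≥1 (sumTo-mono-≤ K (λ _ i<K → vertex-layers i<K)))
                           (≤-reflexive (sym (trans ball≡layers (sumTo-suc K layer))))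

  module _ (r₁r₂ : Adj G r₁ r₂) where

    edge-layers : ∀ {d} → d ≤ K → 2 * pow (δ ∸ 1) d ≤ layer d
    edge-layers {zero}  _     = count-≥2 (λ v → level v ≟ 0) (Adj⇒≢ G r₁r₂) level-r₁ level-r₂
    edge-layers {suc d} d<K = ≤-trans (≤-reflexive (x*[y*z]≡x*z*y 2 (δ ∸ 1) (pow (δ ∸ 1) d)))
      (≤-trans (*-monoˡ-≤ (δ ∸ 1) (edge-layers (<⇒≤ d<K)))
               (layer-growth d<K (λ lw≡ → downward-≤1 lw≡ d<K)))

    edge-moore : 2 + sumTo K (λ i → 2 * pow (δ ∸ 1) (suc i)) ≤ count (NearRoot? K)
    edge-moore = ≤-trans (+-mono-≤ (edge-layers z≤n) (sumTo-mono-≤ K (λ _ i<K → edge-layers i<K)))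
                         (≤-reflexive (sym (trans ball≡layers (sumTo-suc K layer))))

odd?-double : ∀ K → odd? (K + K) ≡ false
odd?-double zero    = refl
odd?-double (suc K) rewrite +-suc K K = odd?-double K

odd?-1+double : ∀ K → odd? (suc (K + K)) ≡ true
odd?-1+double zero    = refl
odd?-1+double (suc K) rewrite +-suc K K = odd?-1+double K

kOf-1+2K+e : ∀ K e → e < 2 → kOf (suc (K + K + e)) ≡ K
kOf-1+2K+e K e e<2 = cong (_∸ 1) (begin
  (suc (K + K + e) + 1) / 2   ≡⟨ /-congˡ (rearrange K e) ⟩
  (e + suc K * 2) / 2         ≡⟨ +-distrib-/-∣ʳ e (divides-refl (suc K)) ⟩
  e / 2 + suc K * 2 / 2       ≡⟨ cong₂ _+_ (m<n⇒m/n≡0 e<2) (m*n/n≡m (suc K) 2) ⟩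
  suc K                       ∎)
  where
  open ≡-Reasoning
  rearrange : ∀ K e → suc (K + K + e) + 1 ≡ e + suc K * 2
  rearrange = solve-∀

Moore-odd : ∀ δ g → odd? g ≡ true → Moore δ g ≡ 1 + sumTo (kOf g) (λ i → δ * pow (δ ∸ 1) i)
Moore-odd δ g odd with odd? g
Moore-odd δ g refl | true = refl

Moore-even : ∀ δ g → odd? g ≡ false → Moore δ g ≡ 2 + sumTo (kOf g) (λ i → 2 * pow (δ ∸ 1) (suc i))
Moore-even δ g even with odd? g
Moore-even δ g refl | false = refl

moore-bound : ∀ {n} {G : Graph n} {e r₁ r₂} (root : Root G e r₁ r₂) K →
  (∀ {m} → Cycle G m → suc (K + K + e) ≤ m) → ∀ {δ} → (∀ v → δ ≤ degree G v) →
  Moore δ (suc (K + K + e)) ≤ count (Levels.NearRoot? root K K)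
moore-bound root@vertex K girth {δ} minDegree = ≤-trans (≤-reflexive Moore≡) (MooreTree.vertex-moore root K girth minDegree refl)
  where
  Moore≡ : Moore δ (suc (K + K + 0)) ≡ 1 + sumTo K (λ i → δ * pow (δ ∸ 1) i)
  Moore≡ = trans (Moore-odd δ (suc (K + K + 0)) (trans (cong (odd? ∘ suc) (+-identityʳ (K + K))) (odd?-1+double K)))
                 (cong (λ k → 1 + sumTo k (λ i → δ * pow (δ ∸ 1) i)) (kOf-1+2K+e K 0 (s≤s z≤n)))
moore-bound root@(edge r₁r₂) K girth {δ} minDegree = ≤-trans (≤-reflexive Moore≡) (MooreTree.edge-moore root K girth minDegree r₁r₂)
  where
  Moore≡ : Moore δ (suc (K + K + 1)) ≡ 2 + sumTo K (λ i → 2 * pow (δ ∸ 1) (suc i))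
  Moore≡ = trans (Moore-even δ (suc (K + K + 1)) (trans (cong (odd? ∘ suc) (+-comm (K + K) 1)) (odd?-double K)))
                 (cong (λ k → 2 + sumTo k (λ i → 2 * pow (δ ∸ 1) (suc i))) (kOf-1+2K+e K 1 (s≤s (s≤s z≤n))))

girth-split : ∀ g → 1 ≤ g → ∃[ e ] (e ≤ 1 × g ≡ suc (kOf g + kOf g + e))
girth-split (suc g′) _ = g′ % 2 , ≤-pred (m%n<n g′ 2) , trans (cong suc g′≡) (cong (λ K → suc (K + K + g′ % 2)) (sym kOf≡))
  where
  K = g′ / 2
  g′≡ : g′ ≡ K + K + g′ % 2
  g′≡ = trans (m≡m%n+[m/n]*n g′ 2) (rearrange (g′ % 2) K)
    where
    rearrange : ∀ r K → r + K * 2 ≡ K + K + r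
    rearrange = solve-∀
  kOf≡ : kOf (suc g′) ≡ K
  kOf≡ = trans (cong (kOf ∘ suc) g′≡) (kOf-1+2K+e K (g′ % 2) (m%n<n g′ 2))

-- H is a set of positions modulo q, encoded as a q-periodic predicate on ℕ, whose points are
-- pairwise at cyclic distance at most D.
module Cluster {h} {H : Pred ℕ h} (H? : Decidable H) {q D : ℕ} (wide : 3 * D + 3 < q)
  (shift⁺ : ∀ {p} → H p → H (p + q)) (shift⁻ : ∀ {p} → H (p + q) → H p)
  (close : ∀ {p t} → t < q → H p → H (p + t) → t ≤ D ⊎ q ≤ t + D) where

  private
    not-above : ∀ {x y z} → x ≤ D → y ≤ D → z ≤ D → ¬ q ≤ x + y + z + 3
    not-above x≤D y≤D z≤D = <⇒≱ (≤-<-trans (+-monoˡ-≤ 3 (+-mono-≤ (+-mono-≤ x≤D y≤D) z≤D))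
                                            (≤-<-trans (≤-reflexive (cong (_+ 3) (D+D+D≡3D D))) wide))
      where
      D+D+D≡3D : ∀ D → D + D + D ≡ 3 * D
      D+D+D≡3D = solve-∀

    not-above₃ : ∀ {x y z} → x ≤ D → y ≤ D → z ≤ D → ¬ q ≤ x + y + z
    not-above₃ x≤D y≤D z≤D q≤ = not-above x≤D y≤D z≤D (≤-trans q≤ (m≤m+n _ 3))

    not-above₁ : ¬ q ≤ suc D
    not-above₁ q≤1+D = not-above (≤-refl {D}) (z≤n {D}) (z≤n {D})
      (≤-trans q≤1+D (≤-trans (≤-reflexive (1+D≡ D)) (+-monoʳ-≤ (D + 0 + 0) (s≤s z≤n))))
      where
      1+D≡ : ∀ D → suc D ≡ D + 0 + 0 + 1
      1+D≡ = solve-∀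

    below₂ : ∀ {x y} → x ≤ D → y ≤ D → x + y < q
    below₂ {x} {y} x≤D y≤D =
      ≰⇒> λ q≤x+y → not-above₃ x≤D y≤D (z≤n {D}) (≤-trans q≤x+y (≤-reflexive (sym (+-identityʳ _))))

  pair-unique : ∀ {p t} → t < q → H p → H (p + D) → H (p + t) → H (p + t + D) → t ≡ 0
  pair-unique {p} {t} t<q Hp HpD Hpt HptD with close t<q Hp Hpt
  ... | inj₁ t≤D with close (below₂ t≤D ≤-refl) Hp (subst H (+-assoc p t D) HptD)
  ...   | inj₁ t+D≤D   = n≤0⇒n≡0 (+-cancelʳ-≤ D t 0 t+D≤D)
  ...   | inj₂ q≤t+D+D = ⊥-elim (not-above₃ t≤D ≤-refl ≤-refl q≤t+D+D)
  pair-unique {p} {t} t<q Hp HpD Hpt HptD | inj₂ q≤t+D with m≤n⇒∃[o]m+o≡n (<⇒≤ t<q)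
  ... | r , refl with close (below₂ r≤D ≤-refl) Hpt (subst H (sym (wrap p t r D)) (shift⁺ HpD))
    where
    r≤D : r ≤ D
    r≤D = +-cancelˡ-≤ t r D q≤t+D
    wrap : ∀ p t r D → p + t + (r + D) ≡ p + D + (t + r)
    wrap = solve-∀
  ...   | inj₁ r+D≤D   = ⊥-elim (<-irrefl (sym (trans (cong (t +_) (n≤0⇒n≡0 (+-cancelʳ-≤ D r 0 r+D≤D))) (+-identityʳ t))) t<q)
  ...   | inj₂ q≤r+D+D = ⊥-elim (not-above₃ (+-cancelˡ-≤ t r D q≤t+D) ≤-refl ≤-refl q≤r+D+D)

  arc : ∀ {a₀} → H a₀ → ∃[ a ] (H a × (∀ {x} → x < q → H (a + x) → x ≤ D))
  arc {a₀} Ha₀ = b + s* , Hs* , contained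
    where
    1+D≤q : suc D ≤ q
    1+D≤q = subst (_< q) (+-identityʳ D) (below₂ ≤-refl z≤n)
    b = a₀ + (q ∸ suc D)
    Hb : H (b + suc D)
    Hb = subst H (sym (trans (+-assoc a₀ _ (suc D)) (cong (a₀ +_) (m∸n+n≡m 1+D≤q)))) (shift⁺ Ha₀)
    Start? : Decidable (λ s → H (b + s))
    Start? s = H? (b + s)
    s* = least Start? (suc (suc D))
    s*≤1+D : s* ≤ suc D
    s*≤1+D = least-minimal Start? (suc (suc D)) Hb ≤-refl
    Hs* : H (b + s*)
    Hs* = least-found Start? (suc (suc D)) (s≤s s*≤1+D)
    contained : ∀ {x} → x < q → H (b + s* + x) → x ≤ D
    contained {x} x<q Hx with close x<q Hs* Hx
    ... | inj₁ x≤D   = x≤D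
    ... | inj₂ q≤x+D = ⊥-elim (beyond (m≤n⇒∃[o]m+o≡n (≤-trans 1+D≤x (m≤n+m x s*))))
      where
      1+D≤x : suc D ≤ x
      1+D≤x = ≰⇒> λ x≤D → <⇒≱ (below₂ x≤D ≤-refl) q≤x+D
      beyond : ∃[ t ] (suc D + t ≡ s* + x) → ⊥
      beyond (t , 1+D+t≡s*+x) with close t<q Hb (subst H regroup Hx)
        where
        t<q : t < q
        t<q = ≤-<-trans (+-cancelˡ-≤ (suc D) t x (≤-trans (≤-reflexive 1+D+t≡s*+x) (+-monoˡ-≤ x s*≤1+D))) x<q
        regroup : b + s* + x ≡ b + suc D + t
        regroup = trans (+-assoc b s* x) (trans (cong (b +_) (sym 1+D+t≡s*+x)) (sym (+-assoc b (suc D) t)))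
      ... | inj₁ t≤D = not-above ≤-refl t≤D ≤-refl (begin
        q                ≤⟨ q≤x+D ⟩
        x + D            ≤⟨ +-monoˡ-≤ D (m≤n+m x s*) ⟩
        s* + x + D       ≡⟨ cong (_+ D) 1+D+t≡s*+x ⟨
        suc (D + t + D)  ≤⟨ ≤-trans (≤-reflexive (+-comm 1 _)) (+-monoʳ-≤ _ (s≤s z≤n)) ⟩
        D + t + D + 3    ∎)
        where open ≤-Reasoning
      ... | inj₂ q≤t+D with m≤n⇒∃[o]m+o≡n (≤-trans q≤t+D (≤-trans (≤-reflexive (+-comm t D))
                                                    (≤-trans (n≤1+n (D + t)) (≤-reflexive 1+D+t≡s*+x))))
      ...   | y , q+y≡s*+x = <⇒≱ y<s* (least-minimal Start? (suc (suc D)) Hy (≤-trans y<s* (m≤n⇒m≤1+n s*≤1+D)))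
        where
        Hy : H (b + y)
        Hy = shift⁻ (subst H (trans (+-assoc b s* x) (trans (cong (b +_) (trans (sym q+y≡s*+x) (+-comm q y))) (sym (+-assoc b y q)))) Hx)
        y<s* : y < s*
        y<s* = +-cancelˡ-< q y s* (subst (_< q + s*) (sym q+y≡s*+x) (≤-trans (+-monoʳ-< s* x<q) (≤-reflexive (+-comm s* q))))

  module _ {e} (e≤1 : e ≤ 1) where

    occupancy : ℕ
    occupancy = sumTo q (λ p → χ (H? p ⊎-dec H? (p + e)))

    private
      f : ℕ → ℕ
      f p = χ (H? p ⊎-dec H? (p + e))

      e≤q : e ≤ q
      e≤q = ≤-trans e≤1 (≰⇒> λ q≤0 → not-above₁ (≤-trans q≤0 z≤n))

      f-periodic : ∀ p → f (p + q) ≡ f p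
      f-periodic p = χ-cong to from (H? (p + q) ⊎-dec H? (p + q + e)) (H? p ⊎-dec H? (p + e))
        where
        swap : p + q + e ≡ p + e + q
        swap = trans (+-assoc p q e) (trans (cong (p +_) (+-comm q e)) (sym (+-assoc p e q)))
        to : H (p + q) ⊎ H (p + q + e) → H p ⊎ H (p + e)
        to (inj₁ h) = inj₁ (shift⁻ h)
        to (inj₂ h) = inj₂ (shift⁻ (subst H swap h))
        from : H p ⊎ H (p + e) → H (p + q) ⊎ H (p + q + e)
        from (inj₁ h) = inj₁ (shift⁺ h)
        from (inj₂ h) = inj₂ (subst H (sym swap) (shift⁺ h))

    module _ {a} (inArc : ∀ {x} → x < q → H (a + x) → x ≤ D) where

      private
        start = a + (q ∸ e)

        window : ∀ {s} → s < q → H (start + s) ⊎ H (start + s + e) → ∃[ x ] (H (a + x) × x ≤ D × s ≤ x + e)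
        window {s} s<q (inj₂ h) = s , Ha+s , inArc s<q Ha+s , m≤m+n s e
          where
          Ha+s : H (a + s)
          Ha+s = shift⁻ (subst H (trans (regroup a (q ∸ e) s e) (cong (a + s +_) (m∸n+n≡m e≤q))) h)
            where
            regroup : ∀ a r s e → a + r + s + e ≡ a + s + (r + e)
            regroup = solve-∀
        window {s} s<q (inj₁ h) with e ≤? s
        ... | yes e≤s with m≤n⇒∃[o]m+o≡n e≤s
        ...   | x , refl = x , Ha+x , inArc (≤-<-trans (m≤n+m x e) s<q) Ha+x , ≤-reflexive (+-comm e x)
          where
          Ha+x : H (a + x)
          Ha+x = shift⁻ (subst H (trans (regroup a (q ∸ e) e x) (cong (a + x +_) (m∸n+n≡m e≤q))) h)
            where
            regroup : ∀ a r e x → a + r + (e + x) ≡ a + x + (r + e)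
            regroup = solve-∀
        window {s} s<q (inj₁ h) | no e≰s = ⊥-elim (not-above₁ q≤1+D)
          where
          x = q ∸ e + s
          x<q : x < q
          x<q = ≤-trans (+-monoʳ-< (q ∸ e) (≰⇒> e≰s)) (≤-reflexive (m∸n+n≡m e≤q))
          q≤1+D : q ≤ suc D
          q≤1+D = begin
            q          ≡⟨ m∸n+n≡m e≤q ⟨
            q ∸ e + e  ≤⟨ +-monoʳ-≤ (q ∸ e) e≤1 ⟩
            q ∸ e + 1  ≤⟨ +-monoˡ-≤ 1 (m≤m+n (q ∸ e) s) ⟩
            x + 1      ≤⟨ +-monoˡ-≤ 1 (inArc x<q (subst H (+-assoc a (q ∸ e) s) h)) ⟩
            D + 1      ≡⟨ +-comm D 1 ⟩
            suc D      ∎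
            where open ≤-Reasoning

        rotated : occupancy ≡ sumTo q (λ s → f (start + s))
        rotated = sym (sumTo-rotate q f f-periodic start)

        vanishes : ∀ {s} → s < q → ¬ (H (start + s) ⊎ H (start + s + e)) → f (start + s) ≡ 0
        vanishes {s} _ none = χ-no (H? (start + s) ⊎-dec H? (start + s + e)) none

      occupancy-≤-arc : occupancy ≤ suc (D + e)
      occupancy-≤-arc = ≤-trans (≤-reflexive rotated) (sumTo-window q (suc (D + e)) (λ s → f (start + s)) (λ p → χ≤1 _)
        λ s 1+D+e≤s s<q → vanishes s<q λ h → let (x , _ , x≤D , s≤x+e) = window s<q h in
          <⇒≱ 1+D+e≤s (≤-trans s≤x+e (+-monoˡ-≤ e x≤D)))

      occupancy-full-arc : suc (D + e) ≤ occupancy → H (a + D)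
      occupancy-full-arc full with H? (a + D)
      ... | yes HaD = HaD
      ... | no ¬HaD = ⊥-elim (<⇒≱ full (≤-trans (≤-reflexive rotated) (sumTo-window q (D + e) (λ s → f (start + s)) (λ p → χ≤1 _)
        λ s D+e≤s s<q → vanishes s<q λ h → let (x , Hax , x≤D , s≤x+e) = window s<q h in
          ¬HaD (subst (λ y → H (a + y)) (≤-antisym x≤D (+-cancelʳ-≤ e D x (≤-trans D+e≤s s≤x+e))) Hax))))

    private
      occupancy-empty : (∀ {p} → p < q → ¬ H p) → occupancy ≤ 0
      occupancy-empty none = sumTo-window q 0 f (λ p → χ≤1 _) λ s _ s<q → χ-no (H? s ⊎-dec H? (s + e)) (absent s<q)
        where
        absent : ∀ {s} → s < q → ¬ (H s ⊎ H (s + e))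
        absent s<q (inj₁ h) = none s<q h
        absent {s} s<q (inj₂ h) with s + e <? q
        ... | yes s+e<q = none s+e<q h
        ... | no  s+e≮q = none (≤-trans (s≤s z≤n) s<q) (shift⁻ (subst H s+e≡0+q h))
          where
          s+e≡0+q : s + e ≡ 0 + q
          s+e≡0+q = ≤-antisym (≤-trans (+-monoʳ-≤ s e≤1) (≤-trans (≤-reflexive (+-comm s 1)) s<q)) (≮⇒≥ s+e≮q)

    occupancy-≤ : occupancy ≤ suc (D + e)
    occupancy-≤ with anyUpTo? H? q
    ... | yes (_ , _ , Ha₀) = let (a , _ , inArc) = arc Ha₀ in occupancy-≤-arc inArc
    ... | no  none          = ≤-trans (occupancy-empty (λ p<q Hp → none (_ , p<q , Hp))) z≤n

    occupancy-full : suc (D + e) ≤ occupancy → ∃[ p ] (H p × H (p + D))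
    occupancy-full full with anyUpTo? H? q
    ... | yes (_ , _ , Ha₀) = let (a , Ha , inArc) = arc Ha₀ in a , Ha , occupancy-full-arc inArc full
    ... | no  none          = ⊥-elim (<⇒≱ (≤-<-trans (occupancy-empty (λ p<q Hp → none (_ , p<q , Hp))) (s≤s z≤n)) full)

module CyclePositions {n} {G : Graph n} {q′} (C : Cycle G (suc q′)) where

  q : ℕ
  q = suc q′

  u : ℕ → Fin n
  u x = vert C (x mod q)

  toℕ-mod : ∀ x → toℕ (x mod q) ≡ x % q
  toℕ-mod x = toℕ-fromℕ< _

  [x%q+y]%q : ∀ x y → (x % q + y) % q ≡ (x + y) % q
  [x%q+y]%q x y = begin
    (x % q + y) % q           ≡⟨ %-distribˡ-+ (x % q) y q ⟩
    (x % q % q + y % q) % q   ≡⟨ cong (λ r → (r + y % q) % q) (m%n%n≡m%n x q) ⟩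
    (x % q + y % q) % q       ≡⟨ %-distribˡ-+ x y q ⟨
    (x + y) % q               ∎
    where open ≡-Reasoning

  u-mod : ∀ x y → x % q ≡ y % q → u x ≡ u y
  u-mod x y x≡y = cong (vert C) (toℕ-injective (trans (toℕ-mod x) (trans x≡y (sym (toℕ-mod y)))))

  u-reduce : ∀ x y → u (toℕ (x mod q) + y) ≡ u (x + y)
  u-reduce x y = u-mod (toℕ (x mod q) + y) (x + y) (trans (cong (λ r → (r + y) % q) (toℕ-mod x)) ([x%q+y]%q x y))

  u-periodic : ∀ x m → u (x + m * q) ≡ u x
  u-periodic x m = u-mod (x + m * q) x ([m+kn]%n≡m%n x m q)

  u-+q : ∀ x → u (x + q) ≡ u x
  u-+q x = u-mod (x + q) x ([m+n]%n≡m%n x q)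

  u-toℕ : ∀ i → u (toℕ i) ≡ vert C i
  u-toℕ i = cong (vert C) (toℕ-injective (trans (toℕ-fromℕ< _) (m<n⇒m%n≡m (toℕ<n i))))

  u-adj : ∀ x → Adj G (u x) (u (suc x))
  u-adj x = subst (Adj G (u x)) (trans (u-reduce x 1) (cong u (+-comm x 1))) (edges C (x mod q))

  u-walk : ∀ x m → Walk G (u x) (u (x + m)) m
  u-walk x zero    = subst (λ y → Walk G (u x) (u y) 0) (sym (+-identityʳ x)) nil
  u-walk x (suc m) = cons (u-adj x) (subst (λ y → Walk G (u (suc x)) (u y) m) (sym (+-suc x m)) (u-walk (suc x) m))

  ∣x-[x+t]%q∣ : ∀ {x t} → x < q → t < q → ∣ x - (x + t) % q ∣ ≡ t ⊎ ∣ x - (x + t) % q ∣ ≡ q ∸ t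
  ∣x-[x+t]%q∣ {x} {t} x<q t<q with x + t <? q
  ... | yes x+t<q = inj₁ (trans (cong (λ y → ∣ x - y ∣) (m<n⇒m%n≡m x+t<q))
                               (trans (m≤n⇒∣m-n∣≡n∸m (m≤m+n x t)) (m+n∸m≡n x t)))
  ... | no  x+t≮q with m≤n⇒∃[o]m+o≡n (≮⇒≥ x+t≮q)
  ...   | w , q+w≡x+t = inj₂ (trans (cong (λ y → ∣ x - y ∣) [x+t]%q≡w) (trans (m≤n⇒∣n-m∣≡n∸m w≤x) x∸w≡q∸t))
    where
    w<q : w < q
    w<q = +-cancelˡ-< q w q (subst (_< q + q) (sym q+w≡x+t) (+-mono-<-≤ x<q (<⇒≤ t<q)))
    [x+t]%q≡w : (x + t) % q ≡ w
    [x+t]%q≡w = trans (cong (_% q) (trans (sym q+w≡x+t) (+-comm q w))) (trans ([m+n]%n≡m%n w q) (m<n⇒m%n≡m w<q))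
    w+[q∸t]≡x : w + (q ∸ t) ≡ x
    w+[q∸t]≡x = +-cancelʳ-≡ t _ _ (trans (+-assoc w (q ∸ t) t)
                                  (trans (cong (w +_) (m∸n+n≡m (<⇒≤ t<q))) (trans (+-comm w q) q+w≡x+t)))
    w≤x : w ≤ x
    w≤x = ≤-trans (m≤m+n w (q ∸ t)) (≤-reflexive w+[q∸t]≡x)
    x∸w≡q∸t : x ∸ w ≡ q ∸ t
    x∸w≡q∸t = trans (cong (_∸ w) (sym w+[q∸t]≡x)) (m+n∸m≡n w (q ∸ t))

  cdist-shift : ∀ p {t} → t < q → cdist q (p mod q) ((p + t) mod q) ≡ t ⊓ (q ∸ t)
  cdist-shift p {t} t<q = trans (cong (λ d → d ⊓ (q ∸ d)) positions) (symmetric (∣x-[x+t]%q∣ (m%n<n p q) t<q))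
    where
    positions : ∣ toℕ (p mod q) - toℕ ((p + t) mod q) ∣ ≡ ∣ p % q - (p % q + t) % q ∣
    positions = cong₂ ∣_-_∣ (toℕ-mod p) (trans (toℕ-mod (p + t)) (sym ([x%q+y]%q p t)))
    symmetric : ∀ {d} → d ≡ t ⊎ d ≡ q ∸ t → d ⊓ (q ∸ d) ≡ t ⊓ (q ∸ t)
    symmetric (inj₁ refl) = refl
    symmetric (inj₂ refl) = trans (cong ((q ∸ t) ⊓_) (m∸[m∸n]≡n (<⇒≤ t<q))) (⊓-comm (q ∸ t) t)

  module _ (k : ℕ) (v : Fin n) where

    Near : ℕ → Set
    Near p = InBall G k (u p) v

    Near? : ∀ p → Dec (Near p)
    Near? p = InBall? G k (u p) v

    Near-+q : ∀ {p} → Near p → Near (p + q)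
    Near-+q {p} = subst (λ w → InBall G k w v) (sym (u-+q p))

    Near-∸q : ∀ {p} → Near (p + q) → Near p
    Near-∸q {p} = subst (λ w → InBall G k w v) (u-+q p)

    Near-close : IsIsometric G C → ∀ {p t} → t < q → Near p → Near (p + t) → t ≤ k + k ⊎ q ≤ t + (k + k)
    Near-close iso {p} {t} t<q (ℓ₁ , ℓ₁≤k , W₁) (ℓ₂ , ℓ₂≤k , W₂) =
      split (≤-trans cdist≤ℓ₁+ℓ₂ (+-mono-≤ ℓ₁≤k ℓ₂≤k))
      where
      cdist≤ℓ₁+ℓ₂ : t ⊓ (q ∸ t) ≤ ℓ₁ + ℓ₂
      cdist≤ℓ₁+ℓ₂ = subst (_≤ ℓ₁ + ℓ₂) (cdist-shift p t<q)
        (≮⇒≥ λ shorter → proj₂ (iso (p mod q) ((p + t) mod q)) (ℓ₁ + ℓ₂) shorter (W₁ ++ reverse W₂))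
      split : t ⊓ (q ∸ t) ≤ k + k → t ≤ k + k ⊎ q ≤ t + (k + k)
      split close with ⊓-sel t (q ∸ t)
      ... | inj₁ ⊓≡t   = inj₁ (subst (_≤ k + k) ⊓≡t close)
      ... | inj₂ ⊓≡q∸t = inj₂ (≤-trans (≤-reflexive (sym (m∸n+n≡m (<⇒≤ t<q))))
                                (≤-trans (+-monoˡ-≤ t (subst (_≤ k + k) ⊓≡q∸t close)) (≤-reflexive (+-comm (k + k) t))))

    Near-cong : ∀ {w w′} → w ≡ w′ → InBall G k w v → InBall G k w′ v
    Near-cong = subst (λ w → InBall G k w v)

module Partition {n} {G : Graph n} {g δ q′} (E : Equatorial G g δ (suc q′))
                 (C : Cycle G (suc q′)) (iso : IsIsometric G C) where

  open CyclePositions C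
  open Equatorial E

  k = kOf g
  D = k + k

  private
    split = girth-split g (≤-trans (s≤s z≤n) (len≥3 (proj₁ girth)))
    e = proj₁ split
    e≤1 : e ≤ 1
    e≤1 = proj₁ (proj₂ split)
    g≡1+D+e : g ≡ suc (D + e)
    g≡1+D+e = proj₂ (proj₂ split)

    wide : 3 * D + 3 < q
    wide = subst (λ x → x + 3 < q) (6k≡3[k+k] k) big
      where
      6k≡3[k+k] : ∀ k → 6 * k ≡ 3 * (k + k)
      6k≡3[k+k] = solve-∀

    module Positions (v : Fin n) = Cluster (Near? k v) wide (λ {p} → Near-+q k v {p}) (λ {p} → Near-∸q k v {p})
                                         (λ {p} {t} → Near-close k v iso {p} {t})

    root-at : ∀ {e} → e ≤ 1 → ∀ p → Root G e (u p) (u (p + e))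
    root-at z≤n       p = subst (λ x → Root G 0 (u p) (u x)) (sym (+-identityʳ p)) vertex
    root-at (s≤s z≤n) p = subst (λ x → Root G 1 (u p) (u x)) (+-comm 1 p) (edge (u-adj p))

    NearEither? : ∀ p v → Dec (Near k v p ⊎ Near k v (p + e))
    NearEither? p v = Near? k v p ⊎-dec Near? k v (p + e)

    occupancy : Fin n → ℕ
    occupancy v = Positions.occupancy v e≤1

    ball-around : ∀ p → Moore δ g ≤ count (NearEither? p)
    ball-around p = subst (λ h → Moore δ h ≤ count (NearEither? p)) (sym g≡1+D+e)
      (moore-bound (root-at e≤1 p) k (λ C′ → subst (_≤ _) g≡1+D+e (proj₂ girth C′)) (proj₂ mindeg))

    occupancy-total : n * g ≤ ∑[ v < n ] occupancy v
    occupancy-total = begin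
      n * g                                    ≡⟨ order ⟩
      q * Moore δ g                            ≡⟨ sumTo-const q (Moore δ g) ⟨
      sumTo q (λ _ → Moore δ g)                ≤⟨ sumTo-mono-≤ q (λ p _ → ball-around p) ⟩
      sumTo q (λ p → count (NearEither? p))    ≡⟨ sumTo-∑-comm q (λ p v → χ (NearEither? p v)) ⟩
      ∑[ v < n ] occupancy v                   ∎
      where open ≤-Reasoning

    covered : ∀ v → ∃[ p ] (Near k v p × Near k v (p + D))
    covered v = Positions.occupancy-full v e≤1 (subst (_≤ occupancy v) g≡1+D+e g≤occupancy)
      where
      occupancy≤g : ∀ v → occupancy v ≤ g
      occupancy≤g v = subst (occupancy v ≤_) (sym g≡1+D+e) (Positions.occupancy-≤ v e≤1)
      g≤occupancy : g ≤ occupancy v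
      g≤occupancy = n*m≤sum⇒m≤each g occupancy occupancy≤g occupancy-total v

  -- vert C (unshift i k) is u (toℕ i + k * q′), i.e. u_{i-k}.
  L-covers : ∀ v → ∃[ i ] InL G C k i v
  L-covers v with covered v
  ... | p , Hp , HpD = (p + k) mod q , Near-cong k v (sym left) Hp , Near-cong k v (sym right) HpD
    where
    left : u (toℕ ((p + k) mod q) + k * q′) ≡ u p
    left = trans (u-reduce (p + k) (k * q′)) (trans (cong u (regroup p k q′)) (u-periodic p k))
      where
      regroup : ∀ p k q′ → p + k + k * q′ ≡ p + k * suc q′
      regroup = solve-∀
    right : u (toℕ ((p + k) mod q) + k) ≡ u (p + D)
    right = trans (u-reduce (p + k) k) (cong u (+-assoc p k k))

  private
    L-unique-≤ : ∀ {v i j} → toℕ i ≤ toℕ j → InL G C k i v → InL G C k j v → toℕ i ≡ toℕ j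
    L-unique-≤ {v} {i} {j} i≤j (Hi₁ , Hi₂) (Hj₁ , Hj₂) with m≤n⇒∃[o]m+o≡n i≤j
    ... | t , x+t≡y = trans (sym (+-identityʳ x)) (trans (cong (x +_) (sym t≡0)) x+t≡y)
      where
      x = toℕ i
      far : ∀ y → u (y + k) ≡ u (y + k * q′ + D)
      far y = trans (sym (u-periodic (y + k) k)) (cong u (regroup y k q′))
        where
        regroup : ∀ y k q′ → y + k + k * suc q′ ≡ y + k * q′ + (k + k)
        regroup = solve-∀
      shuffle : toℕ j + k * q′ ≡ x + k * q′ + t
      shuffle = trans (cong (_+ k * q′) (sym x+t≡y)) (swap x t k q′)
        where
        swap : ∀ x t k q′ → x + t + k * q′ ≡ x + k * q′ + t
        swap = solve-∀
      t≡0 : t ≡ 0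
      t≡0 = Positions.pair-unique v {x + k * q′} (≤-<-trans (m≤n+m t x) (subst (_< q) (sym x+t≡y) (toℕ<n j)))
              Hi₁ (Near-cong k v (far x) Hi₂) (Near-cong k v (cong u shuffle) Hj₁)
              (Near-cong k v (trans (far (toℕ j)) (cong (λ y → u (y + D)) shuffle)) Hj₂)

  L-unique : ∀ v i j → InL G C k i v → InL G C k j v → i ≡ j
  L-unique v i j Li Lj with ≤-total (toℕ i) (toℕ j)
  ... | inj₁ i≤j = toℕ-injective (L-unique-≤ i≤j Li Lj)
  ... | inj₂ j≤i = sym (toℕ-injective (L-unique-≤ j≤i Lj Li))

  L-centre : ∀ i → InL G C k i (vert C i)
  L-centre i = (k , ≤-refl , subst (λ w → Walk G (u (toℕ i + k * q′)) w k) (trans around (u-toℕ i))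
                                   (u-walk (toℕ i + k * q′) k))
             , (k , ≤-refl , subst (λ w → Walk G (u (toℕ i + k)) w k) (u-toℕ i) (reverse (u-walk (toℕ i) k)))
    where
    around : u (toℕ i + k * q′ + k) ≡ u (toℕ i)
    around = trans (cong u (regroup (toℕ i) k q′)) (u-periodic (toℕ i) k)
      where
      regroup : ∀ x k q′ → x + k * q′ + k ≡ x + k * suc q′
      regroup = solve-∀

lemma16 : {n : ℕ} (G : Graph n) (g δ q : ℕ) → Equatorial G g δ q →
    (C : Cycle G q) → IsIsometric G C →
    ((v : Fin n) → ∃[ i ] InL G C (kOf g) i v)
    × ((v : Fin n) (i j : Fin q) → InL G C (kOf g) i v → InL G C (kOf g) j v → i ≡ j)
    × ((i : Fin q) → InL G C (kOf g) i (vert C i))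
lemma16 G g δ zero     E C iso = ⊥-elim (n≮0 (Equatorial.big E))
lemma16 G g δ (suc q′) E C iso = L-covers , L-unique , L-centre
  where open Partition E C iso
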